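{- Let $\mathcal C$ be an irredundant coherent configuration. If $f$ is an algebraic isomorphism from $\mathcal C$ to a coherent configuration $\mathcal C'$, then there exists a combinatorial isomorphism $\phi$ from $\mathcal C$ to $\mathcal C'$ such that $\phi(R)=f(R)$ for every basis relation $R$ contained in $X\times X$, for every fiber $X$ of $\mathcal C$.
   Context: A coherent configuration on a finite set $V$ is a partition $\mathcal C$ of $V\times V$ into basis relations such that: (A) a basis relation containing a loop consists of loops; (B) the transpose of a basis relation is a basis relation; (C) for all $R,S,T\in\mathcal C$ the number $|\{w:uw\in R,wv\in S\}|$ is the same for all $uv\in T$, denoted $p^T_{RS}$. Fibers are sets $X$ with $\{xx:x\in X\}\in\mathcal C$; $\mathcal C[X,Y]$ is the set of basis relations in $X\times Y$, uniform if equal to $\{X\times Y\}$. For distinct 4-point fibers, $\mathcal C[X,Y]$ is of type $2K_{2,2}$ if it consists of two basis relations $R$ and $(X\times Y)\setminus R$ with $R=\{x_1,x_2\}\times\{y_1,y_2\}\cup\{x_3,x_4\}\times\{y_3,y_4\}$ for suitable enumerations. $\mathcal C$ is indecomposable if the fibers cannot be split into two nonempty parts with all interspaces between the parts uniform. $\mathcal C$ is irredundant if it is indecomposable, all its fibers have size $4$, and every non-uniform interspace $\mathcal C[X,Y]$ ($X\ne Y$) is of type $2K_{2,2}$. A combinatorial isomorphism is a bijection $\phi$ of point sets with $\phi(R)\in\mathcal C'$ for all $R\in\mathcal C$; an algebraic isomorphism is a bijection $f:\mathcal C\to\mathcal C'$ with $p^T_{RS}=p^{f(T)}_{f(R)f(S)}$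 for all $R,S,T$. -}

module Defs where

open import Data.Nat using (ℕ; zero; suc; _+_)
open import Data.Fin using (Fin; zero; suc)
open import Data.Fin.Properties using (_≟_)
open import Data.Bool using (Bool; true; false; if_then_else_; _∧_)
open import Data.Product using (Σ; ∃; _×_; _,_; proj₁; proj₂)
open import Relation.Nullary using (¬_)
open import Relation.Nullary.Decidable using (⌊_⌋)
open import Relation.Binary.PropositionalEquality using (_≡_; _≢_)
open import Function.Bundles using (_⇔_)
open import Function.Definitions using (Bijective)

count : ∀ {n} → (Fin n → Bool) → ℕ
count {zero}  p = 0
count {suc n} p = (if p zero then 1 else 0) + count (λ w → p (suc w))

-- A coherent configuration on the point set V = Fin n whose basis relations
-- are indexed by Fin r: the basis relation R_i is {uv : col u v ≡ i}.
record CC (n r : ℕ) : Set where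
  field
    col    : Fin n → Fin n → Fin r
    nonempty : ∀ i → Σ (Fin n) λ u → Σ (Fin n) λ v → col u v ≡ i
    axA    : ∀ i u → col u u ≡ i → ∀ v w → col v w ≡ i → v ≡ w
    axB    : ∀ i → Σ (Fin r) λ j → ∀ u v → (col u v ≡ i) ⇔ (col v u ≡ j)
    axC    : ∀ i j k u v u' v' → col u v ≡ k → col u' v' ≡ k →
             count (λ w → ⌊ col u w ≟ i ⌋ ∧ ⌊ col w v ≟ j ⌋)
               ≡ count (λ w → ⌊ col u' w ≟ i ⌋ ∧ ⌊ col w v' ≟ j ⌋)

module _ {n r : ℕ} (C : CC n r) where
  open CC C

  isect : Fin r → Fin r → Fin r → ℕ
  isect i j k =
    let u = proj₁ (nonempty k) ; v = proj₁ (proj₂ (nonempty k)) in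
    count (λ w → ⌊ col u w ≟ i ⌋ ∧ ⌊ col w v ≟ j ⌋)

  -- R_a is the diagonal of a fiber: X_a = {x : col x x ≡ a}
  IsFiber : Fin r → Set
  IsFiber a = (Σ (Fin n) λ x → col x x ≡ a) × (∀ u v → col u v ≡ a → u ≡ v)

  InFiber : Fin r → Fin n → Set
  InFiber a x = col x x ≡ a

  RelIn : Fin r → Fin r → Fin r → Set
  RelIn j a b = ∀ u v → col u v ≡ j → InFiber a u × InFiber b v

  Uniform : Fin r → Fin r → Set
  Uniform a b = Σ (Fin r) λ j → ∀ u v → (InFiber a u × InFiber b v) ⇔ (col u v ≡ j)

  Enumerates : Fin r → (Fin 4 → Fin n) → Set
  Enumerates a e = (∀ p q → e p ≡ e q → p ≡ q) × (∀ x → InFiber a x ⇔ (Σ (Fin 4) λ p → e p ≡ x))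

  firstHalf : Fin 4 → Bool
  firstHalf zero = true
  firstHalf (suc zero) = true
  firstHalf (suc (suc _)) = false

  Block : (Fin 4 → Fin n) → (Fin 4 → Fin n) → Fin n → Fin n → Set
  Block ex ey u v = Σ (Fin 4) λ p → Σ (Fin 4) λ q →
                      (ex p ≡ u) × (ey q ≡ v) × (firstHalf p ≡ firstHalf q)

  Type2K22 : Fin r → Fin r → Set
  Type2K22 a b = Σ (Fin r) λ j → Σ (Fin r) λ j' →
    Σ (Fin 4 → Fin n) λ ex → Σ (Fin 4 → Fin n) λ ey →
      Enumerates a ex × Enumerates b ey × RelIn j a b × RelIn j' a b ×
      (∀ u v → InFiber a u → InFiber b v →
         ((col u v ≡ j) ⇔ Block ex ey u v) × ((col u v ≡ j') ⇔ (¬ Block ex ey u v)))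

  Decomposable : Set
  Decomposable = Σ (Fin r → Bool) λ S →
    (Σ (Fin r) λ a → IsFiber a × S a ≡ true) ×
    (Σ (Fin r) λ b → IsFiber b × S b ≡ false) ×
    (∀ a b → IsFiber a → IsFiber b → S a ≡ true → S b ≡ false →
       Uniform a b × Uniform b a)

  Indecomposable : Set
  Indecomposable = ¬ Decomposable

  Irredundant : Set
  Irredundant = Indecomposable ×
    (∀ a → IsFiber a → count (λ x → ⌊ col x x ≟ a ⌋) ≡ 4) ×
    (∀ a b → IsFiber a → IsFiber b → a ≢ b → ¬ Uniform a b → Type2K22 a b)

AlgIso : ∀ {n r n' r'} → CC n r → CC n' r' → (Fin r → Fin r') → Set
AlgIso C C' f = Bijective _≡_ _≡_ f ×
  (∀ i j k → isect C i j k ≡ isect C' (f i) (f j) (f k))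

InImage : ∀ {n r n'} → CC n r → (Fin n → Fin n') → Fin r → Fin n' → Fin n' → Set
InImage {n} C φ i u' v' =
  Σ (Fin n) λ u → Σ (Fin n) λ v → (φ u ≡ u') × (φ v ≡ v') × (CC.col C u v ≡ i)

ImageIs : ∀ {n r n' r'} → CC n r → CC n' r' → (Fin n → Fin n') → Fin r → Fin r' → Set
ImageIs C C' φ i j = ∀ u' v' → InImage C φ i u' v' ⇔ (CC.col C' u' v' ≡ j)

CombIso : ∀ {n r n' r'} → CC n r → CC n' r' → (Fin n → Fin n') → Set
CombIso {r' = r'} C C' φ = Bijective _≡_ _≡_ φ ×
  (∀ i → Σ (Fin r') λ j → ImageIs C C' φ i j)

-- Fix a base point o = pt₁ a in every fibre X_a of C, and let o′ be the base point of the fibre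
-- X_(f a) of C′. An algebraic isomorphism preserves valencies, so for each relation i the
-- i-neighbourhood of o and the (f i)-neighbourhood of o′ have the same size; matching them fibre by
-- fibre gives a bijection φ with col′ o′ (φ x) = f (col o x). Let κ x y be the relation that f sends
-- to col′ (φ x) (φ y). Then φ is a combinatorial isomorphism as soon as col x y and κ x y determine
-- each other, and it induces f on a fibre as soon as κ = col there.
--
-- Inside a fibre of size 4 the triangle φ o, φ x, φ y of C′ pulls back to C and forces κ x y = col x y:
-- either x is the only (col o x)-neighbour of o, or the three points other than o leave no room for a
-- different outcome. Uniform interspaces are trivial. In an interspace of type 2K₂,₂ every relation
-- is the block or the off-block relation, i.e. the parity of the halves containing its endpoints.
-- Moving one endpoint inside its fibre changes this parity for col and for κ alike, since the change
-- is read off the relation between the old and the new endpoint, on which col and κ agree. So col and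
-- κ have the same parity up to a constant, and determine each other.

module Submission where

open import Defs
open import Algebra.Bundles using (CommutativeRing)
open import Data.Bool using (Bool; true; false; if_then_else_; _∧_; _∨_; _xor_)
open import Data.Bool.Properties
  using (∧-conicalˡ; ∧-conicalʳ; xor-∧-commutativeRing; xor-assoc; xor-comm; xor-same; xor-annihilates-not)
open import Data.Empty using (⊥-elim)
open import Data.Fin using (Fin; zero; suc; cast; toℕ)
open import Data.Fin.Properties
  using (_≟_; suc-injective; any?; all?; toℕ-injective; toℕ-cast; cast-involutive)
open import Data.Nat using (ℕ; zero; suc; _+_; _≤_; z≤n; s≤s)
import Data.Nat.Properties as ℕ
open import Data.Product using (Σ; ∃; _×_; _,_; proj₁; proj₂)
open import Data.Sum using (_⊎_; inj₁; inj₂)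
open import Function.Bundles using (_⇔_; mk⇔; Equivalence)
open import Function.Definitions using (Bijective)
open import Function.Base using (case_of_)
open import Relation.Binary.PropositionalEquality
open import Relation.Nullary using (¬_; yes; no; Dec)
open import Relation.Nullary.Decidable using (⌊_⌋; map′; _×-dec_; _→-dec_)

open CommutativeRing xor-∧-commutativeRing using (+-commutativeSemigroup)
open import Algebra.Properties.CommutativeSemigroup +-commutativeSemigroup using (interchange)

≟-sound : ∀ {m} {a b : Fin m} → ⌊ a ≟ b ⌋ ≡ true → a ≡ b
≟-sound {a = a} {b} h with a ≟ b
... | yes a≡b = a≡b

≟-complete : ∀ {m} {a b : Fin m} → a ≡ b → ⌊ a ≟ b ⌋ ≡ true
≟-complete {a = a} {b} a≡b with a ≟ b
... | yes _   = refl
... | no a≢b = ⊥-elim (a≢b a≡b)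

≟-≢ : ∀ {m} {a b : Fin m} → a ≢ b → ⌊ a ≟ b ⌋ ≡ false
≟-≢ {a = a} {b} a≢b with a ≟ b
... | yes a≡b = ⊥-elim (a≢b a≡b)
... | no _    = refl

xor-≡ : ∀ {x y} → x ≡ y → x xor y ≡ false
xor-≡ {x} refl = xor-same x

xor-≢ : ∀ {x y} → x ≢ y → x xor y ≡ true
xor-≢ {false} {false} x≢y = ⊥-elim (x≢y refl)
xor-≢ {false} {true}  _   = refl
xor-≢ {true}  {false} _   = refl
xor-≢ {true}  {true}  x≢y = ⊥-elim (x≢y refl)

xor≡false⇒≡ : ∀ {x y} → x xor y ≡ false → x ≡ y
xor≡false⇒≡ {false} {false} _ = refl
xor≡false⇒≡ {true}  {true}  _ = refl

xor-cong-⇔ : ∀ {x y x′ y′} → x ≡ y ⇔ x′ ≡ y′ → x xor y ≡ x′ xor y′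
xor-cong-⇔ {x} {y} eq with x Data.Bool.≟ y
... | yes x≡y = trans (xor-≡ x≡y) (sym (xor-≡ (Equivalence.to eq x≡y)))
... | no x≢y  = trans (xor-≢ x≢y) (sym (xor-≢ (λ e → x≢y (Equivalence.from eq e))))

xor-≡-⇔ : ∀ {x x′ y y′} → x xor x′ ≡ y xor y′ → x ≡ x′ ⇔ y ≡ y′
xor-≡-⇔ eq = mk⇔ (λ e → xor≡false⇒≡ (trans (sym eq) (xor-≡ e)))
                 (λ e → xor≡false⇒≡ (trans eq (xor-≡ e)))

xor-cancelˡ-common : ∀ z x y → (z xor x) xor (z xor y) ≡ x xor y
xor-cancelˡ-common false x y = refl
xor-cancelˡ-common true  x y = xor-annihilates-not x y

xor-cancelʳ-common : ∀ z x y → (x xor z) xor (y xor z) ≡ x xor y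
xor-cancelʳ-common z x y = trans (cong₂ _xor_ (xor-comm x z) (xor-comm y z)) (xor-cancelˡ-common z x y)

xor-telescope : ∀ x y z → (x xor y) xor (y xor z) ≡ x xor z
xor-telescope x y z = begin
  (x xor y) xor (y xor z)  ≡⟨ xor-assoc x y (y xor z) ⟩
  x xor (y xor (y xor z))  ≡⟨ cong (x xor_) (sym (xor-assoc y y z)) ⟩
  x xor ((y xor y) xor z)  ≡⟨ cong (λ w → x xor (w xor z)) (xor-same y) ⟩
  x xor z                  ∎
  where open ≡-Reasoning

_⇔-dec_ : ∀ {A B : Set} → Dec A → Dec B → Dec (A ⇔ B)
a? ⇔-dec b? = map′ (λ (to , from) → mk⇔ to from) (λ e → Equivalence.to e , Equivalence.from e)
                   ((a? →-dec b?) ×-dec (b? →-dec a?))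

count-cong : ∀ {n} {p q : Fin n → Bool} → (∀ w → p w ≡ q w) → count p ≡ count q
count-cong {zero}  h = refl
count-cong {suc n} h = cong₂ _+_ (cong (λ b → if b then 1 else 0) (h zero)) (count-cong (λ w → h (suc w)))

count-pos : ∀ {n} (p : Fin n → Bool) w → p w ≡ true → 1 ≤ count p
count-pos p zero    pw rewrite pw = s≤s z≤n
count-pos p (suc w) pw = ℕ.≤-trans (count-pos (λ v → p (suc v)) w pw) (ℕ.m≤n+m _ _)

count-witness : ∀ {n} (p : Fin n → Bool) → 1 ≤ count p → ∃ λ w → p w ≡ true
count-witness {suc n} p h with p zero in p0
... | true  = zero , p0
... | false = let w , pw = count-witness (λ v → p (suc v)) h in suc w , pw

count-mono : ∀ {n} (p q : Fin n → Bool) → (∀ w → p w ≡ true → q w ≡ true) → count p ≤ count q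
count-mono {zero}  p q h = z≤n
count-mono {suc n} p q h with p zero in p0 | q zero in q0
... | true  | true  = s≤s (count-mono _ _ (λ w → h (suc w)))
... | true  | false with () ← trans (sym (h zero p0)) q0
count-mono {suc n} p q h | false | true  = ℕ.m≤n⇒m≤1+n (count-mono _ _ (λ w → h (suc w)))
count-mono {suc n} p q h | false | false = count-mono _ _ (λ w → h (suc w))

count-∨ : ∀ {n} (p q : Fin n → Bool) → (∀ w → p w ≡ true → q w ≡ false) →
          count (λ w → p w ∨ q w) ≡ count p + count q
count-∨ {zero}  p q h = refl
count-∨ {suc n} p q h with p zero in p0 | q zero in q0
... | true  | true  with () ← trans (sym (h zero p0)) q0
count-∨ {suc n} p q h | true  | false = cong suc (count-∨ _ _ (λ w → h (suc w)))
count-∨ {suc n} p q h | false | true  = trans (cong suc (count-∨ _ _ (λ w → h (suc w)))) (sym (ℕ.+-suc _ _))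
count-∨ {suc n} p q h | false | false = count-∨ _ _ (λ w → h (suc w))

count-none : ∀ {n} (p : Fin n → Bool) → (∀ w → p w ≡ false) → count p ≡ 0
count-none {zero}  p h = refl
count-none {suc n} p h rewrite h zero = count-none _ (λ w → h (suc w))

count-singleton : ∀ {n} (x : Fin n) → count (λ w → ⌊ w ≟ x ⌋) ≡ 1
count-singleton {suc n} zero = cong suc (count-none {n} _ (λ _ → refl))
count-singleton {suc n} (suc x) = trans (count-cong shift) (count-singleton x)
  where
  shift : ∀ w → ⌊ suc w ≟ suc x ⌋ ≡ ⌊ w ≟ x ⌋
  shift w with w ≟ x
  ... | yes _ = refl
  ... | no _  = refl

count-insert : ∀ {n} (p : Fin n → Bool) x → p x ≡ false →
               count (λ w → p w ∨ ⌊ w ≟ x ⌋) ≡ suc (count p)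
count-insert p x px = begin
  count (λ w → p w ∨ ⌊ w ≟ x ⌋)    ≡⟨ count-∨ p _ disjoint ⟩
  count p + count (λ w → ⌊ w ≟ x ⌋) ≡⟨ cong (count p +_) (count-singleton x) ⟩
  count p + 1                        ≡⟨ ℕ.+-comm (count p) 1 ⟩
  suc (count p)                      ∎
  where
  open ≡-Reasoning
  disjoint : ∀ w → p w ≡ true → ⌊ w ≟ x ⌋ ≡ false
  disjoint w pw = ≟-≢ λ { refl → case trans (sym pw) px of λ () }

count-pair : ∀ {n} {x y : Fin n} → x ≢ y → count (λ w → ⌊ w ≟ x ⌋ ∨ ⌊ w ≟ y ⌋) ≡ 2
count-pair {x = x} {y} x≢y =
  trans (count-insert _ y (≟-≢ (λ y≡x → x≢y (sym y≡x)))) (cong suc (count-singleton x))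

count-≥2 : ∀ {n} (p : Fin n → Bool) {x y} → x ≢ y → p x ≡ true → p y ≡ true → 2 ≤ count p
count-≥2 p {x} {y} x≢y px py = subst (_≤ count p) (count-pair x≢y) (count-mono _ p pair⊆p)
  where
  pair⊆p : ∀ w → (⌊ w ≟ x ⌋ ∨ ⌊ w ≟ y ⌋) ≡ true → p w ≡ true
  pair⊆p w h with w ≟ x | w ≟ y
  ... | yes refl | _        = px
  ... | no _     | yes refl = py

count-≥3 : ∀ {n} (p : Fin n → Bool) {x y z} → x ≢ y → z ≢ x → z ≢ y →
           p x ≡ true → p y ≡ true → p z ≡ true → 3 ≤ count p
count-≥3 p {x} {y} {z} x≢y z≢x z≢y px py pz =
  subst (_≤ count p) (trans (count-insert _ z z∉pair) (cong suc (count-pair x≢y))) (count-mono _ p triple⊆p)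
  where
  z∉pair : (⌊ z ≟ x ⌋ ∨ ⌊ z ≟ y ⌋) ≡ false
  z∉pair rewrite ≟-≢ z≢x | ≟-≢ z≢y = refl
  triple⊆p : ∀ w → ((⌊ w ≟ x ⌋ ∨ ⌊ w ≟ y ⌋) ∨ ⌊ w ≟ z ⌋) ≡ true → p w ≡ true
  triple⊆p w h with w ≟ x | w ≟ y | w ≟ z
  ... | yes refl | _        | _        = px
  ... | no _     | yes refl | _        = py
  ... | no _     | no _     | yes refl = pz

count≡1-unique : ∀ {n} (p : Fin n → Bool) {x y} → count p ≡ 1 → p x ≡ true → p y ≡ true → x ≡ y
count≡1-unique p {x} {y} c px py with x ≟ y
... | yes x≡y = x≡y
... | no x≢y with s≤s () ← subst (2 ≤_) c (count-≥2 p x≢y px py)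

count≡2-cases : ∀ {n} (p : Fin n → Bool) {x y w} → count p ≡ 2 → x ≢ y →
                p x ≡ true → p y ≡ true → p w ≡ true → w ≡ x ⊎ w ≡ y
count≡2-cases p {x} {y} {w} c x≢y px py pw with w ≟ x | w ≟ y
... | yes w≡x | _       = inj₁ w≡x
... | no _    | yes w≡y = inj₂ w≡y
... | no w≢x  | no w≢y with s≤s (s≤s ()) ← subst (3 ≤_) c (count-≥3 p x≢y w≢x w≢y px py pw)

record Enumeration {n} (p : Fin n → Bool) (m : ℕ) : Set where
  field
    point           : Fin m → Fin n
    point-injective : ∀ {q s} → point q ≡ point s → q ≡ s
    point-sat       : ∀ q → p (point q) ≡ true
    point-onto      : ∀ x → p x ≡ true → ∃ λ q → point q ≡ x

module _ {n m} {p : Fin (suc n) → Bool} (E : Enumeration (λ w → p (suc w)) m) where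
  open Enumeration E

  enumeration-skip : p zero ≡ false → Enumeration p m
  enumeration-skip p0 = record
    { point           = λ q → suc (point q)
    ; point-injective = λ eq → point-injective (suc-injective eq)
    ; point-sat       = point-sat
    ; point-onto      = onto
    }
    where
    onto : ∀ x → p x ≡ true → ∃ λ q → suc (point q) ≡ x
    onto zero    px with () ← trans (sym p0) px
    onto (suc x) px = let q , eq = point-onto x px in q , cong suc eq

  enumeration-take : p zero ≡ true → Enumeration p (suc m)
  enumeration-take p0 = record
    { point           = point′
    ; point-injective = injective
    ; point-sat       = sat
    ; point-onto      = onto
    }
    where
    point′ : Fin (suc m) → Fin (suc n)
    point′ zero    = zero
    point′ (suc q) = suc (point q)
    injective : ∀ {q s} → point′ q ≡ point′ s → q ≡ s
    injective {zero}  {zero}  _  = refl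
    injective {suc q} {suc s} eq = cong suc (point-injective (suc-injective eq))
    sat : ∀ q → p (point′ q) ≡ true
    sat zero    = p0
    sat (suc q) = point-sat q
    onto : ∀ x → p x ≡ true → ∃ λ q → point′ q ≡ x
    onto zero    _  = zero , refl
    onto (suc x) px = let q , eq = point-onto x px in suc q , cong suc eq

enumerate : ∀ {n} (p : Fin n → Bool) → Enumeration p (count p)
enumerate {zero}  p = record { point = λ () ; point-injective = λ { {()} } ; point-sat = λ () ; point-onto = λ () }
enumerate {suc n} p with p zero in p0
... | true  = enumeration-take (enumerate _) p0
... | false = enumeration-skip (enumerate _) p0

module Matching {n n'} (p : Fin n → Bool) (p' : Fin n' → Bool) where
  private
    module E  = Enumeration (enumerate p)
    module E′ = Enumeration (enumerate p')

  match : .(count p ≡ count p') → ∀ x → p x ≡ true → Fin n'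
  match e x px = E′.point (cast e (proj₁ (E.point-onto x px)))

  match-sat : ∀ .e x px → p' (match e x px) ≡ true
  match-sat e x px = E′.point-sat _

  match-cong : ∀ .e x px px′ → match e x px ≡ match e x px′
  match-cong e x px px′ = cong (λ q → E′.point (cast e q))
    (E.point-injective (trans (proj₂ (E.point-onto x px)) (sym (proj₂ (E.point-onto x px′)))))

  match-injective : ∀ .e {x y} px py → match e x px ≡ match e y py → x ≡ y
  match-injective e {x} {y} px py eq =
    let qx , ex = E.point-onto x px
        qy , ey = E.point-onto y py
        qx≡qy = toℕ-injective (trans (sym (toℕ-cast e qx))
                  (trans (cong toℕ (E′.point-injective eq)) (toℕ-cast e qy)))
    in trans (sym ex) (trans (cong E.point qx≡qy) ey)

  match-onto : ∀ .e y' → p' y' ≡ true → ∃ λ x → Σ (p x ≡ true) λ px → match e x px ≡ y'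
  match-onto e y' py' =
    let q′ , eq′ = E′.point-onto y' py'
        q = cast (sym e) q′
        px = E.point-sat q
        q₀ , eq₀ = E.point-onto (E.point q) px
    in E.point q , px ,
       trans (cong (λ s → E′.point (cast e s)) (E.point-injective eq₀))
             (trans (cong E′.point (cast-involutive e (sym e) q′)) eq′)

module CoherentTheory {n r} (D : CC n r) where
  open CC D

  pt₁ pt₂ : Fin r → Fin n
  pt₁ k = proj₁ (nonempty k)
  pt₂ k = proj₁ (proj₂ (nonempty k))

  pt-col : ∀ k → col (pt₁ k) (pt₂ k) ≡ k
  pt-col k = proj₂ (proj₂ (nonempty k))

  nbhd : Fin n → Fin r → Fin n → Bool
  nbhd u i w = ⌊ col u w ≟ i ⌋

  valency : Fin n → Fin r → ℕ
  valency u i = count (nbhd u i)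

  valency-pos : ∀ {u v i} → col u v ≡ i → 1 ≤ valency u i
  valency-pos {u} {v} e = count-pos (nbhd u _) v (≟-complete e)

  isect-at : ∀ {i j k u v} → col u v ≡ k →
             count (λ w → ⌊ col u w ≟ i ⌋ ∧ ⌊ col w v ≟ j ⌋) ≡ isect D i j k
  isect-at {i} {j} {k} {u} {v} e = axC i j k u v (pt₁ k) (pt₂ k) e (pt-col k)

  isect-pos : ∀ {i j k u v} w → col u v ≡ k → col u w ≡ i → col w v ≡ j → 1 ≤ isect D i j k
  isect-pos w e e₁ e₂ =
    subst (1 ≤_) (isect-at e) (count-pos _ w (cong₂ _∧_ (≟-complete e₁) (≟-complete e₂)))

  isect-witness : ∀ {i j k u v} → col u v ≡ k → 1 ≤ isect D i j k →
                  ∃ λ w → col u w ≡ i × col w v ≡ j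
  isect-witness e pos =
    let w , pw = count-witness _ (subst (1 ≤_) (sym (isect-at e)) pos)
    in w , ≟-sound (∧-conicalˡ _ _ pw) , ≟-sound (∧-conicalʳ _ _ pw)

  Diag : Fin r → Set
  Diag a = ∀ u v → col u v ≡ a → u ≡ v

  loop-Diag : ∀ u → Diag (col u u)
  loop-Diag u = axA (col u u) u refl

  Diag⇒isect≡0 : ∀ {a j} → Diag a → j ≢ a → isect D a j a ≡ 0
  Diag⇒isect≡0 {a} {j} d j≢a = ℕ.n≤0⇒n≡0 (ℕ.≮⇒≥ λ pos →
    let w , e₁ , e₂ = isect-witness (pt-col a) pos
    in j≢a (trans (sym e₂) (trans (cong (λ z → col z (pt₂ a)) (sym (d _ _ e₁))) (pt-col a))))

  isect≡0⇒Diag : ∀ {a} → (∀ j → j ≢ a → isect D a j a ≡ 0) → Diag a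
  isect≡0⇒Diag {a} h u v e with col v v ≟ a
  ... | yes e′ = axA a v e′ u v e
  ... | no ne with () ← subst (1 ≤_) (h _ ne) (isect-pos v e e refl)

  pt-loop : ∀ {a} → Diag a → col (pt₁ a) (pt₁ a) ≡ a
  pt-loop {a} d = trans (cong (col (pt₁ a)) (d _ _ (pt-col a))) (pt-col a)

  source target : Fin r → Fin r
  source i = col (pt₁ i) (pt₁ i)
  target i = col (pt₂ i) (pt₂ i)

  source-col : ∀ {u v i} → col u v ≡ i → col u u ≡ source i
  source-col {u} {v} {i} e =
    let w , e₁ , _ = isect-witness (pt-col i) (isect-pos u e refl e)
    in trans (sym e₁) (cong (col (pt₁ i)) (sym (loop-Diag u _ _ e₁)))

  target-col : ∀ {u v i} → col u v ≡ i → col v v ≡ target i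
  target-col {u} {v} {i} e =
    let w , _ , e₂ = isect-witness (pt-col i) (isect-pos v e e refl)
    in trans (sym e₂) (cong (λ z → col z (pt₂ i)) (loop-Diag v _ _ e₂))

  source-isect : ∀ i → 1 ≤ isect D (source i) i i
  source-isect i = isect-pos (pt₁ i) (pt-col i) refl (pt-col i)

  target-isect : ∀ i → 1 ≤ isect D i (target i) i
  target-isect i = isect-pos (pt₂ i) (pt-col i) (pt-col i) refl

  source-unique : ∀ {a i} → Diag a → 1 ≤ isect D a i i → source i ≡ a
  source-unique {a} {i} d pos =
    let w , e₁ , _ = isect-witness (pt-col i) pos
    in trans (cong (col (pt₁ i)) (d _ _ e₁)) e₁

  target-unique : ∀ {b i} → Diag b → 1 ≤ isect D i b i → target i ≡ b
  target-unique {b} {i} d pos =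
    let w , _ , e₂ = isect-witness (pt-col i) pos
    in trans (cong (λ z → col z (pt₂ i)) (sym (d _ _ e₂))) e₂

  _ᵀ : Fin r → Fin r
  i ᵀ = proj₁ (axB i)

  ᵀ-col : ∀ {u v i} → col u v ≡ i → col v u ≡ i ᵀ
  ᵀ-col {u} {v} {i} = Equivalence.to (proj₂ (axB i) u v)

  ᵀ-col⁻¹ : ∀ {u v i} → col v u ≡ i ᵀ → col u v ≡ i
  ᵀ-col⁻¹ {u} {v} {i} = Equivalence.from (proj₂ (axB i) u v)

  ᵀ-isect : ∀ i → 1 ≤ isect D i (i ᵀ) (source i)
  ᵀ-isect i = isect-pos (pt₂ i) refl (pt-col i) (ᵀ-col (pt-col i))

  ᵀ-unique : ∀ {i j} → 1 ≤ isect D i j (source i) → j ≡ i ᵀ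
  ᵀ-unique {i} {j} pos =
    let w , e₁ , e₂ = isect-witness {u = pt₁ i} refl pos
    in trans (sym e₂) (ᵀ-col e₁)

  valency≡isect : ∀ u i → valency u i ≡ isect D i (i ᵀ) (col u u)
  valency≡isect u i = trans (count-cong there-and-back) (isect-at refl)
    where
    there-and-back : ∀ w → nbhd u i w ≡ (⌊ col u w ≟ i ⌋ ∧ ⌊ col w u ≟ i ᵀ ⌋)
    there-and-back w with col u w ≟ i
    ... | yes e = sym (≟-complete (ᵀ-col e))
    ... | no _  = refl

  valency-fiber : ∀ {u v} i → col u u ≡ col v v → valency u i ≡ valency v i
  valency-fiber {u} {v} i e =
    trans (valency≡isect u i) (trans (cong (isect D i (i ᵀ)) e) (sym (valency≡isect v i)))

  valency-Diag : ∀ {a u} → Diag a → col u u ≡ a → valency u a ≡ 1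
  valency-Diag {a} {u} d e = trans (count-cong only-u) (count-singleton u)
    where
    only-u : ∀ w → nbhd u a w ≡ ⌊ w ≟ u ⌋
    only-u w with col u w ≟ a | w ≟ u
    ... | yes e′ | no w≢u = ⊥-elim (w≢u (sym (d _ _ e′)))
    ... | no ne  | yes refl = ⊥-elim (ne e)
    ... | yes _  | yes _ = refl
    ... | no _   | no _  = refl

  xor-determined : ∀ {c} (h : Fin n → Bool) (P : Fin r → Set) →
                   (∀ {u w} → col u u ≡ c → col w w ≡ c → h u ≡ h w ⇔ P (col u w)) →
                   ∀ {u w u′ w′} → col u u ≡ c → col w w ≡ c → col u′ u′ ≡ c → col w′ w′ ≡ c →
                   col u w ≡ col u′ w′ → h u xor h w ≡ h u′ xor h w′
  xor-determined h P char u∈ w∈ u′∈ w′∈ e = xor-cong-⇔ (mk⇔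
    (λ s → Equivalence.from (char u′∈ w′∈) (subst P e (Equivalence.to (char u∈ w∈) s)))
    (λ s → Equivalence.from (char u∈ w∈) (subst P (sym e) (Equivalence.to (char u′∈ w′∈) s))))

module AlgebraicIsomorphism {n r n' r'} (C : CC n r) (C' : CC n' r')
                            (f : Fin r → Fin r') (alg : AlgIso C C' f) where
  open CC C
  open CoherentTheory C
  module C′ = CoherentTheory C'
  open CC C' using () renaming (col to col′)

  f-injective : ∀ {i j} → f i ≡ f j → i ≡ j
  f-injective = proj₁ (proj₁ alg)

  f⁻¹ : Fin r' → Fin r
  f⁻¹ y = proj₁ (proj₂ (proj₁ alg) y)

  f-f⁻¹ : ∀ y → f (f⁻¹ y) ≡ y
  f-f⁻¹ y = proj₂ (proj₂ (proj₁ alg) y) refl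

  f-isect : ∀ i j k → isect C i j k ≡ isect C' (f i) (f j) (f k)
  f-isect = proj₂ alg

  pull-pos : ∀ {i j k} → 1 ≤ isect C' (f i) (f j) (f k) → 1 ≤ isect C i j k
  pull-pos {i} {j} {k} = subst (1 ≤_) (sym (f-isect i j k))

  push-pos : ∀ {i j k} → 1 ≤ isect C i j k → 1 ≤ isect C' (f i) (f j) (f k)
  push-pos {i} {j} {k} = subst (1 ≤_) (f-isect i j k)

  Diag-f : ∀ {a} → Diag a → C′.Diag (f a)
  Diag-f {a} d = C′.isect≡0⇒Diag vanish
    where
    vanish : ∀ j′ → j′ ≢ f a → isect C' (f a) j′ (f a) ≡ 0
    vanish j′ j′≢fa = begin
      isect C' (f a) j′ (f a)            ≡⟨ cong (λ z → isect C' (f a) z (f a)) (sym (f-f⁻¹ j′)) ⟩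
      isect C' (f a) (f (f⁻¹ j′)) (f a)  ≡⟨ sym (f-isect a (f⁻¹ j′) a) ⟩
      isect C a (f⁻¹ j′) a               ≡⟨ Diag⇒isect≡0 d (λ e → j′≢fa (trans (sym (f-f⁻¹ j′)) (cong f e))) ⟩
      0                                  ∎
      where open ≡-Reasoning

  Diag-f⁻¹ : ∀ {a} → C′.Diag (f a) → Diag a
  Diag-f⁻¹ {a} d = isect≡0⇒Diag λ j j≢a →
    trans (f-isect a j a) (C′.Diag⇒isect≡0 d (λ e → j≢a (f-injective e)))

  source-f : ∀ i → C′.source (f i) ≡ f (source i)
  source-f i = C′.source-unique (Diag-f (loop-Diag (pt₁ i))) (push-pos (source-isect i))

  target-f : ∀ i → C′.target (f i) ≡ f (target i)
  target-f i = C′.target-unique (Diag-f (loop-Diag (pt₂ i))) (push-pos (target-isect i))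

  ᵀ-f : ∀ i → f i C′.ᵀ ≡ f (i ᵀ)
  ᵀ-f i = sym (C′.ᵀ-unique (subst (λ z → 1 ≤ isect C' (f i) (f (i ᵀ)) z)
                                  (sym (source-f i)) (push-pos (ᵀ-isect i))))

  valency-f : ∀ {u u′} i → col′ u′ u′ ≡ f (col u u) → valency u i ≡ C′.valency u′ (f i)
  valency-f {u} {u′} i e = begin
    valency u i                             ≡⟨ valency≡isect u i ⟩
    isect C i (i ᵀ) (col u u)               ≡⟨ f-isect i (i ᵀ) (col u u) ⟩
    isect C' (f i) (f (i ᵀ)) (f (col u u))  ≡⟨ cong₂ (isect C' (f i)) (sym (ᵀ-f i)) (sym e) ⟩
    isect C' (f i) (f i C′.ᵀ) (col′ u′ u′)  ≡⟨ sym (C′.valency≡isect u′ (f i)) ⟩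
    C′.valency u′ (f i)                     ∎
    where open ≡-Reasoning

  valency-base : ∀ {a} i → Diag a → valency (pt₁ a) i ≡ C′.valency (C′.pt₁ (f a)) (f i)
  valency-base {a} i d = valency-f i (trans (C′.pt-loop (Diag-f d)) (cong f (sym (pt-loop d))))

  -- The proof of Diag a is irrelevant, so ψ does not depend on it (see φ-as-ψ).
  ψ : ∀ a i → .(Diag a) → ∀ x → col (pt₁ a) x ≡ i → Fin n'
  ψ a i d x e = Matching.match (nbhd (pt₁ a) i) (C′.nbhd (C′.pt₁ (f a)) (f i))
                               (valency-base i d) x (≟-complete e)

  ψ-col : ∀ a i .(d : Diag a) x (e : col (pt₁ a) x ≡ i) → col′ (C′.pt₁ (f a)) (ψ a i d x e) ≡ f i
  ψ-col a i d x e = ≟-sound (Matching.match-sat (nbhd (pt₁ a) i) (C′.nbhd (C′.pt₁ (f a)) (f i))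
                                                (valency-base i d) x (≟-complete e))

  -- Opaque: unfolding φ exposes the enumerations and makes elaboration of later lemmas very slow.
  opaque
    φ : Fin n → Fin n'
    φ x = ψ (col x x) (col (pt₁ (col x x)) x) (loop-Diag x) x refl

    φ-as-ψ : ∀ {x a i} (d : Diag a) (ea : col x x ≡ a) (ei : col (pt₁ a) x ≡ i) → φ x ≡ ψ a i d x ei
    φ-as-ψ d refl refl = refl

    φ-base : ∀ {x a} → col x x ≡ a → col′ (C′.pt₁ (f a)) (φ x) ≡ f (col (pt₁ a) x)
    φ-base {x} refl = ψ-col _ _ (loop-Diag x) x refl

  φ-fiber : ∀ x → col′ (φ x) (φ x) ≡ f (col x x)
  φ-fiber x = trans (C′.target-col (φ-base refl)) (trans (target-f _) (cong f (sym (target-col refl))))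

  φ-injective : ∀ {x y} → φ x ≡ φ y → x ≡ y
  φ-injective {x} {y} φx≡φy =
    Matching.match-injective _ _ (valency-base _ (loop-Diag y)) (≟-complete same-step) (≟-complete refl)
      (trans (sym (φ-as-ψ (loop-Diag y) same-fiber same-step)) (trans φx≡φy (φ-as-ψ (loop-Diag y) refl refl)))
    where
    same-fiber : col x x ≡ col y y
    same-fiber = f-injective (trans (sym (φ-fiber x)) (trans (cong (λ z → col′ z z) φx≡φy) (φ-fiber y)))
    same-step : col (pt₁ (col y y)) x ≡ col (pt₁ (col y y)) y
    same-step = f-injective (trans (sym (φ-base same-fiber)) (trans (cong (col′ _) φx≡φy) (φ-base refl)))

  φ-surjective : ∀ y′ → ∃ λ x → φ x ≡ y′
  φ-surjective y′ = x , (begin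
    φ x                                          ≡⟨ φ-as-ψ d x∈a (≟-sound px) ⟩
    ψ a i d x (≟-sound px)                       ≡⟨ Matching.match-cong p p′ _ x _ px ⟩
    Matching.match p p′ (valency-base i d) x px  ≡⟨ φx≡y′ ⟩
    y′                                           ∎)
    where
    open ≡-Reasoning
    a = f⁻¹ (col′ y′ y′)
    fa-loop : col′ y′ y′ ≡ f a
    fa-loop = sym (f-f⁻¹ _)
    d : Diag a
    d = Diag-f⁻¹ (subst C′.Diag fa-loop (C′.loop-Diag y′))
    i = f⁻¹ (col′ (C′.pt₁ (f a)) y′)
    p = nbhd (pt₁ a) i
    p′ = C′.nbhd (C′.pt₁ (f a)) (f i)
    onto = Matching.match-onto p p′ (valency-base i d) y′ (≟-complete (sym (f-f⁻¹ _)))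
    x = proj₁ onto
    px = proj₁ (proj₂ onto)
    φx≡y′ = proj₂ (proj₂ onto)
    x∈a : col x x ≡ a
    x∈a = trans (target-col (≟-sound px)) (f-injective (begin
      f (target i)                        ≡⟨ sym (target-f i) ⟩
      C′.target (f i)                     ≡⟨ cong C′.target (f-f⁻¹ _) ⟩
      C′.target (col′ (C′.pt₁ (f a)) y′)  ≡⟨ sym (C′.target-col refl) ⟩
      col′ y′ y′                          ≡⟨ fa-loop ⟩
      f a                                 ∎))

  φ-base-point : ∀ {a} → Diag a → φ (pt₁ a) ≡ C′.pt₁ (f a)
  φ-base-point d = sym (Diag-f d _ _ (trans (φ-base (pt-loop d)) (cong f (pt-loop d))))

  κ : Fin n → Fin n → Fin r
  κ x y = f⁻¹ (col′ (φ x) (φ y))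

  f-κ : ∀ x y → f (κ x y) ≡ col′ (φ x) (φ y)
  f-κ x y = f-f⁻¹ _

  κ-source : ∀ x y → source (κ x y) ≡ col x x
  κ-source x y = f-injective (begin
    f (source (κ x y))            ≡⟨ sym (source-f _) ⟩
    C′.source (f (κ x y))         ≡⟨ cong C′.source (f-κ x y) ⟩
    C′.source (col′ (φ x) (φ y))  ≡⟨ sym (C′.source-col refl) ⟩
    col′ (φ x) (φ x)              ≡⟨ φ-fiber x ⟩
    f (col x x)                   ∎)
    where open ≡-Reasoning

  κ-target : ∀ x y → target (κ x y) ≡ col y y
  κ-target x y = f-injective (begin
    f (target (κ x y))            ≡⟨ sym (target-f _) ⟩
    C′.target (f (κ x y))         ≡⟨ cong C′.target (f-κ x y) ⟩
    C′.target (col′ (φ x) (φ y))  ≡⟨ sym (C′.target-col refl) ⟩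
    col′ (φ y) (φ y)              ≡⟨ φ-fiber y ⟩
    f (col y y)                   ∎)
    where open ≡-Reasoning

  κ-Diag : ∀ {x y} → Diag (κ x y) → x ≡ y
  κ-Diag {x} {y} d = φ-injective (subst C′.Diag (f-κ x y) (Diag-f d) _ _ refl)

  κ-transpose : ∀ x y → κ y x ᵀ ≡ κ x y
  κ-transpose x y = f-injective (begin
    f (κ y x ᵀ)                    ≡⟨ sym (ᵀ-f _) ⟩
    f (κ y x) C′.ᵀ                 ≡⟨ cong C′._ᵀ (f-κ y x) ⟩
    col′ (φ y) (φ x) C′.ᵀ          ≡⟨ sym (C′.ᵀ-col refl) ⟩
    col′ (φ x) (φ y)               ≡⟨ sym (f-κ x y) ⟩
    f (κ x y)                      ∎)
    where open ≡-Reasoning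

  κ-triangle : ∀ {u v} x y z → col u v ≡ κ x z → ∃ λ w → col u w ≡ κ x y × col w v ≡ κ y z
  κ-triangle x y z e = isect-witness e
    (pull-pos (C′.isect-pos (φ y) (sym (f-κ x z)) (sym (f-κ x y)) (sym (f-κ y z))))

  κ-base : ∀ {a x} → Diag a → col x x ≡ a → κ (pt₁ a) x ≡ col (pt₁ a) x
  κ-base {a} {x} d x∈a = f-injective
    (trans (f-κ _ x) (trans (cong (λ z → col′ z (φ x)) (φ-base-point d)) (φ-base x∈a)))

  AgreesOn : Fin r → Set
  AgreesOn a = ∀ {x y} → col x x ≡ a → col y y ≡ a → col x y ≡ κ x y

  module SmallFiber {a} (d : Diag a) (size : count (λ x → ⌊ col x x ≟ a ⌋) ≡ 4) where
    o : Fin n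
    o = pt₁ a

    o∈a : col o o ≡ a
    o∈a = pt-loop d

    step-target : ∀ {u x} → col x x ≡ a → target (col u x) ≡ a
    step-target x∈a = trans (sym (target-col refl)) x∈a

    valency-in-fiber : ∀ {u v s} → col u u ≡ a → col u v ≡ s → 1 ≤ valency o s
    valency-in-fiber {s = s} u∈a e = subst (1 ≤_) (valency-fiber s (trans u∈a (sym o∈a))) (valency-pos e)

    ≥2⇒≢a : ∀ {i} → 2 ≤ valency o i → i ≢ a
    ≥2⇒≢a h refl with s≤s () ← subst (2 ≤_) (valency-Diag d o∈a) h

    neighbourhoods-fill : ∀ {s t} → s ≢ t → s ≢ a → t ≢ a → target s ≡ a → target t ≡ a →
                          suc (valency o s + valency o t) ≤ 4
    neighbourhoods-fill {s} {t} s≢t s≢a t≢a ts tt =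
      subst₂ _≤_ (trans (count-insert _ o o∉nbhds) (cong suc (count-∨ (nbhd o s) (nbhd o t) disjoint))) size
             (count-mono _ _ within-fiber)
      where
      disjoint : ∀ w → nbhd o s w ≡ true → nbhd o t w ≡ false
      disjoint w h = ≟-≢ (λ e → s≢t (trans (sym (≟-sound h)) e))
      o∉nbhds : (nbhd o s o ∨ nbhd o t o) ≡ false
      o∉nbhds rewrite ≟-≢ (λ e → s≢a (trans (sym e) o∈a)) | ≟-≢ (λ e → t≢a (trans (sym e) o∈a)) = refl
      within-fiber : ∀ w → ((nbhd o s w ∨ nbhd o t w) ∨ ⌊ w ≟ o ⌋) ≡ true → ⌊ col w w ≟ a ⌋ ≡ true
      within-fiber w h with col o w ≟ s | col o w ≟ t | w ≟ o
      ... | yes e | _     | _      = ≟-complete (trans (target-col e) ts)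
      ... | no _  | yes e | _      = ≟-complete (trans (target-col e) tt)
      ... | no _  | no _  | yes refl = ≟-complete o∈a

    no-room : ∀ {s t} → 4 ≤ s + t → ¬ suc (s + t) ≤ 4
    no-room ge lt = ℕ.<⇒≱ lt ge

    only-relation : ∀ {i s} → 3 ≤ valency o i → target i ≡ a →
                    s ≢ a → target s ≡ a → 1 ≤ valency o s → s ≡ i
    only-relation {i} {s} v₃ ti s≢a ts v₁ with s ≟ i
    ... | yes s≡i = s≡i
    ... | no s≢i = ⊥-elim (no-room {valency o s} {valency o i} (ℕ.+-mono-≤ v₁ v₃)
                             (neighbourhoods-fill s≢i s≢a (≥2⇒≢a (ℕ.≤-trans (ℕ.n≤1+n 2) v₃)) ts ti))

    step-witness : ∀ {x y} → col x x ≡ a → col y y ≡ a →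
                   ∃ λ w → col o w ≡ col o x × col w y ≡ κ x y
    step-witness {x} {y} x∈a y∈a =
      let w , e₁ , e₂ = κ-triangle o x y (sym (κ-base d y∈a))
      in w , trans e₁ (κ-base d x∈a) , e₂

    κ-unique-step : ∀ {x y} → col x x ≡ a → col y y ≡ a → valency o (col o x) ≡ 1 → col x y ≡ κ x y
    κ-unique-step {x} {y} x∈a y∈a v₁ =
      let w , e₁ , e₂ = step-witness x∈a y∈a
          w≡x = count≡1-unique (nbhd o (col o x)) v₁ (≟-complete e₁) (≟-complete refl)
      in subst (λ z → col z y ≡ κ x y) w≡x e₂

    κ-pair : ∀ {x y} → col x x ≡ a → col y y ≡ a → x ≢ y → col o x ≡ col o y →
             valency o (col o x) ≡ 2 → col x y ≡ κ x y
    κ-pair {x} {y} x∈a y∈a x≢y i≡j v₂ with step-witness x∈a y∈a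
    ... | w , e₁ , e₂ with count≡2-cases (nbhd o (col o x)) v₂ x≢y
                             (≟-complete refl) (≟-complete (sym i≡j)) (≟-complete e₁)
    ... | inj₁ refl = e₂
    ... | inj₂ refl = ⊥-elim (x≢y (κ-Diag (subst Diag e₂ (loop-Diag w))))

    κ-triple : ∀ {x y} → col x x ≡ a → col y y ≡ a → x ≢ y →
               3 ≤ valency o (col o x) → col x y ≡ κ x y
    κ-triple {x} {y} x∈a y∈a x≢y v₃ =
      let w , e₁ , e₂ = step-witness x∈a y∈a
          w∈a = trans (target-col e₁) (step-target x∈a)
      in trans (only-relation v₃ (step-target x∈a) (λ e → x≢y (d _ _ e)) (step-target {x} y∈a)
                              (valency-in-fiber x∈a refl))
               (sym (only-relation v₃ (step-target x∈a) (λ e → x≢y (κ-Diag (subst Diag (sym e) d)))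
                                   (trans (κ-target x y) y∈a) (valency-in-fiber w∈a e₂)))

    κ-crowded : ∀ {x y} → col x x ≡ a → col y y ≡ a → x ≢ y →
                2 ≤ valency o (col o x) → 2 ≤ valency o (col o y) → col x y ≡ κ x y
    κ-crowded {x} {y} x∈a y∈a x≢y vx vy with col o x ≟ col o y
    ... | no i≢j = ⊥-elim (no-room {valency o (col o x)} {valency o (col o y)} (ℕ.+-mono-≤ vx vy)
                     (neighbourhoods-fill i≢j (≥2⇒≢a vx) (≥2⇒≢a vy) (step-target x∈a) (step-target y∈a)))
    ... | yes i≡j with valency o (col o x) ℕ.≟ 2
    ... | yes v₂ = κ-pair x∈a y∈a x≢y i≡j v₂
    ... | no v≢2 = κ-triple x∈a y∈a x≢y (ℕ.≤∧≢⇒< vx (λ e → v≢2 (sym e)))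

    κ-fiber : AgreesOn a
    κ-fiber {x} {y} x∈a y∈a with valency o (col o x) ℕ.≟ 1 | valency o (col o y) ℕ.≟ 1 | x ≟ y
    ... | yes v₁ | _      | _        = κ-unique-step x∈a y∈a v₁
    ... | no _   | yes v₁ | _        =
      trans (ᵀ-col refl) (trans (cong _ᵀ (κ-unique-step y∈a x∈a v₁)) (κ-transpose x y))
    ... | no _   | no _   | yes refl = f-injective (trans (sym (φ-fiber x)) (sym (f-κ x x)))
    ... | no vx  | no vy  | no x≢y   =
      κ-crowded x∈a y∈a x≢y (≥2 vx) (≥2 vy)
      where
      ≥2 : ∀ {z} → valency o (col o z) ≢ 1 → 2 ≤ valency o (col o z)
      ≥2 v≢1 = ℕ.≤∧≢⇒< (valency-pos refl) (λ e → v≢1 (sym e))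

  Faithful : Fin r → Fin r → Set
  Faithful a b = ∀ {x y x̃ ỹ} → col x x ≡ a → col y y ≡ b → col x̃ x̃ ≡ a → col ỹ ỹ ≡ b →
                 col x y ≡ col x̃ ỹ ⇔ κ x y ≡ κ x̃ ỹ

  faithful-fiber : ∀ {a} → AgreesOn a → Faithful a a
  faithful-fiber κ-agrees x∈ y∈ x̃∈ ỹ∈ = mk⇔
    (λ e → trans (sym (κ-agrees x∈ y∈)) (trans e (κ-agrees x̃∈ ỹ∈)))
    (λ e → trans (κ-agrees x∈ y∈) (trans e (sym (κ-agrees x̃∈ ỹ∈))))

  faithful-uniform : ∀ {a b} → Uniform C a b → Faithful a b
  faithful-uniform {a} {b} (j , U) x∈ y∈ x̃∈ ỹ∈ = mk⇔
    (λ _ → trans (κ≡j x∈ y∈) (sym (κ≡j x̃∈ ỹ∈)))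
    (λ _ → trans (col≡j x∈ y∈) (sym (col≡j x̃∈ ỹ∈)))
    where
    col≡j : ∀ {u v} → col u u ≡ a → col v v ≡ b → col u v ≡ j
    col≡j {u} {v} u∈ v∈ = Equivalence.to (U u v) (u∈ , v∈)
    κ≡j : ∀ {x y} → col x x ≡ a → col y y ≡ b → κ x y ≡ j
    κ≡j {x} {y} x∈ y∈ = trans (sym (pt-col _)) (col≡j (trans (κ-source x y) x∈) (trans (κ-target x y) y∈))

  module DoubleBlock {a b j₁ j₂} {ex ey : Fin 4 → Fin n}
                     (κ-agrees-a : AgreesOn a) (κ-agrees-b : AgreesOn b)
                     (enX : Enumerates C a ex) (enY : Enumerates C b ey) (j₁∈ : RelIn C j₁ a b)
                     (blocks : ∀ u v → col u u ≡ a → col v v ≡ b →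
                               ((col u v ≡ j₁) ⇔ Block C ex ey u v) × ((col u v ≡ j₂) ⇔ (¬ Block C ex ey u v)))
                     where

    -- Junk value false outside the image of e.
    half : (Fin 4 → Fin n) → Fin n → Bool
    half e u with any? (λ q → e q ≟ u)
    ... | yes (q , _) = firstHalf C q
    ... | no _        = false

    half-point : ∀ {c e} → Enumerates C c e → ∀ q → half e (e q) ≡ firstHalf C q
    half-point {e = e} en q with any? (λ p → e p ≟ e q)
    ... | yes (p , ep≡eq) = cong (firstHalf C) (proj₁ en p q ep≡eq)
    ... | no none         = ⊥-elim (none (q , refl))

    hx hy : Fin n → Bool
    hx = half ex
    hy = half ey

    half-hit : ∀ h → ∃ λ q → firstHalf C q ≡ h
    half-hit true  = zero , refl
    half-hit false = suc (suc zero) , refl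

    ex∈a : ∀ q → col (ex q) (ex q) ≡ a
    ex∈a q = Equivalence.from (proj₂ enX (ex q)) (q , refl)

    ey∈b : ∀ q → col (ey q) (ey q) ≡ b
    ey∈b q = Equivalence.from (proj₂ enY (ey q)) (q , refl)

    Block⇔same-half : ∀ {u v} → col u u ≡ a → col v v ≡ b → Block C ex ey u v ⇔ hx u ≡ hy v
    Block⇔same-half {u} {v} u∈ v∈ = mk⇔ to from
      where
      to : Block C ex ey u v → hx u ≡ hy v
      to (p , q , refl , refl , e) = trans (half-point enX p) (trans e (sym (half-point enY q)))
      from : hx u ≡ hy v → Block C ex ey u v
      from h =
        let p , ep = Equivalence.to (proj₂ enX u) u∈
            q , eq = Equivalence.to (proj₂ enY v) v∈
            hp = trans (sym (half-point enX p)) (cong hx ep)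
            hq = trans (sym (half-point enY q)) (cong hy eq)
        in p , q , ep , eq , trans hp (trans h (sym hq))

    j₁⇔same-half : ∀ {u v} → col u u ≡ a → col v v ≡ b → col u v ≡ j₁ ⇔ hx u ≡ hy v
    j₁⇔same-half {u} {v} u∈ v∈ = mk⇔
      (λ e → Equivalence.to (Block⇔same-half u∈ v∈) (Equivalence.to (proj₁ (blocks u v u∈ v∈)) e))
      (λ h → Equivalence.from (proj₁ (blocks u v u∈ v∈)) (Equivalence.from (Block⇔same-half u∈ v∈) h))

    j₂-off-block : ∀ {u v} → col u u ≡ a → col v v ≡ b → hx u ≢ hy v → col u v ≡ j₂
    j₂-off-block {u} {v} u∈ v∈ h≢ = Equivalence.from (proj₂ (blocks u v u∈ v∈))
      (λ blk → h≢ (Equivalence.to (Block⇔same-half u∈ v∈) blk))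

    j₁≢j₂ : j₁ ≢ j₂
    j₁≢j₂ j₁≡j₂ = Equivalence.to (proj₂ (blocks _ _ (ex∈a zero) (ey∈b zero)))
                    (subst (col (ex zero) (ey zero) ≡_) j₁≡j₂ (Equivalence.from (proj₁ (blocks _ _ (ex∈a zero) (ey∈b zero))) blk))
                    blk
      where
      blk : Block C ex ey (ex zero) (ey zero)
      blk = zero , zero , refl , refl , refl

    rel : Bool → Fin r
    rel false = j₁
    rel true  = j₂

    rel-injective : ∀ {s t} → rel s ≡ rel t → s ≡ t
    rel-injective {false} {false} _ = refl
    rel-injective {false} {true}  e = ⊥-elim (j₁≢j₂ e)
    rel-injective {true}  {false} e = ⊥-elim (j₁≢j₂ (sym e))
    rel-injective {true}  {true}  _ = refl

    col-split : ∀ {u v} → col u u ≡ a → col v v ≡ b → col u v ≡ rel (hx u xor hy v)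
    col-split {u} {v} u∈ v∈ with hx u Data.Bool.≟ hy v
    ... | yes h≡ = subst (λ s → col u v ≡ rel s) (sym (xor-≡ h≡)) (Equivalence.from (j₁⇔same-half u∈ v∈) h≡)
    ... | no h≢  = subst (λ s → col u v ≡ rel s) (sym (xor-≢ h≢)) (j₂-off-block u∈ v∈ h≢)

    bit : Fin r → Bool
    bit k = hx (pt₁ k) xor hy (pt₂ k)

    rel-bit : ∀ {k} → source k ≡ a → target k ≡ b → rel (bit k) ≡ k
    rel-bit {k} sk tk = trans (sym (col-split sk tk)) (pt-col k)

    bit-col : ∀ {u v} → col u u ≡ a → col v v ≡ b → bit (col u v) ≡ hx u xor hy v
    bit-col u∈ v∈ = rel-injective (trans (rel-bit (trans (sym (source-col refl)) u∈)
                                                  (trans (sym (target-col refl)) v∈))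
                                         (col-split u∈ v∈))

    bit-injective : ∀ {k k′} → source k ≡ a → target k ≡ b → source k′ ≡ a → target k′ ≡ b →
                    bit k ≡ bit k′ → k ≡ k′
    bit-injective sk tk sk′ tk′ e = trans (sym (rel-bit sk tk)) (trans (cong rel e) (rel-bit sk′ tk′))

    same-hy⇔ : ∀ {y w} → col y y ≡ b → col w w ≡ b → hy y ≡ hy w ⇔ 1 ≤ isect C (j₁ ᵀ) j₁ (col y w)
    same-hy⇔ {y} {w} y∈ w∈ = mk⇔ to from
      where
      to : hy y ≡ hy w → 1 ≤ isect C (j₁ ᵀ) j₁ (col y w)
      to h = let q , fq = half-hit (hy y)
                 hu = trans (half-point enX q) fq
             in isect-pos (ex q) refl (ᵀ-col (Equivalence.from (j₁⇔same-half (ex∈a q) y∈) hu))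
                                      (Equivalence.from (j₁⇔same-half (ex∈a q) w∈) (trans hu h))
      from : 1 ≤ isect C (j₁ ᵀ) j₁ (col y w) → hy y ≡ hy w
      from pos = let u , e₁ , e₂ = isect-witness refl pos
                     u∈ = proj₁ (j₁∈ u w e₂)
                 in trans (sym (Equivalence.to (j₁⇔same-half u∈ y∈) (ᵀ-col⁻¹ e₁)))
                          (Equivalence.to (j₁⇔same-half u∈ w∈) e₂)

    same-hx⇔ : ∀ {x z} → col x x ≡ a → col z z ≡ a → hx x ≡ hx z ⇔ 1 ≤ isect C j₁ (j₁ ᵀ) (col x z)
    same-hx⇔ {x} {z} x∈ z∈ = mk⇔ to from
      where
      to : hx x ≡ hx z → 1 ≤ isect C j₁ (j₁ ᵀ) (col x z)
      to h = let q , fq = half-hit (hx x)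
                 hv = sym (trans (half-point enY q) fq)
             in isect-pos (ey q) refl (Equivalence.from (j₁⇔same-half x∈ (ey∈b q)) hv)
                                      (ᵀ-col (Equivalence.from (j₁⇔same-half z∈ (ey∈b q)) (trans (sym h) hv)))
      from : 1 ≤ isect C j₁ (j₁ ᵀ) (col x z) → hx x ≡ hx z
      from pos = let v , e₁ , e₂ = isect-witness refl pos
                     v∈ = proj₂ (j₁∈ x v e₁)
                 in trans (Equivalence.to (j₁⇔same-half x∈ v∈) e₁)
                          (sym (Equivalence.to (j₁⇔same-half z∈ v∈) (ᵀ-col⁻¹ e₂)))

    hx-invariant : ∀ {x z x′ z′} → col x x ≡ a → col z z ≡ a → col x′ x′ ≡ a → col z′ z′ ≡ a →
                   col x z ≡ col x′ z′ → hx x xor hx z ≡ hx x′ xor hx z′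
    hx-invariant = xor-determined hx (λ k → 1 ≤ isect C j₁ (j₁ ᵀ) k) same-hx⇔

    hy-invariant : ∀ {y w y′ w′} → col y y ≡ b → col w w ≡ b → col y′ y′ ≡ b → col w′ w′ ≡ b →
                   col y w ≡ col y′ w′ → hy y xor hy w ≡ hy y′ xor hy w′
    hy-invariant = xor-determined hy (λ k → 1 ≤ isect C (j₁ ᵀ) j₁ k) same-hy⇔

    bit-step-x : ∀ {x x̃ y} → col x x ≡ a → col x̃ x̃ ≡ a → col y y ≡ b →
                 bit (κ x y) xor bit (κ x̃ y) ≡ hx x xor hx x̃
    bit-step-x {x} {x̃} {y} x∈ x̃∈ y∈ = begin
      bit (κ x y) xor bit (κ x̃ y)          ≡⟨ cong₂ _xor_ (trans (cong bit (sym (pt-col k))) (bit-col u∈ v∈))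
                                                          (trans (cong bit (sym e₂)) (bit-col w∈ v∈)) ⟩
      (hx u xor hy v) xor (hx w xor hy v)  ≡⟨ xor-cancelʳ-common (hy v) (hx u) (hx w) ⟩
      hx u xor hx w                        ≡⟨ hx-invariant u∈ w∈ x∈ x̃∈ (trans e₁ (sym (κ-agrees-a x∈ x̃∈))) ⟩
      hx x xor hx x̃                        ∎
      where
      open ≡-Reasoning
      k = κ x y
      u = pt₁ k
      v = pt₂ k
      triangle = κ-triangle x x̃ y (pt-col k)
      w = proj₁ triangle
      e₁ : col u w ≡ κ x x̃
      e₁ = proj₁ (proj₂ triangle)
      e₂ : col w v ≡ κ x̃ y
      e₂ = proj₂ (proj₂ triangle)
      u∈ : col u u ≡ a
      u∈ = trans (κ-source x y) x∈
      v∈ : col v v ≡ b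
      v∈ = trans (κ-target x y) y∈
      w∈ : col w w ≡ a
      w∈ = trans (source-col e₂) (trans (κ-source x̃ y) x̃∈)

    bit-step-y : ∀ {x y ỹ} → col x x ≡ a → col y y ≡ b → col ỹ ỹ ≡ b →
                 bit (κ x y) xor bit (κ x ỹ) ≡ hy y xor hy ỹ
    bit-step-y {x} {y} {ỹ} x∈ y∈ ỹ∈ = begin
      bit (κ x y) xor bit (κ x ỹ)          ≡⟨ cong₂ _xor_ (trans (cong bit (sym e₁)) (bit-col u∈ w∈))
                                                          (trans (cong bit (sym (pt-col k))) (bit-col u∈ v∈)) ⟩
      (hx u xor hy w) xor (hx u xor hy v)  ≡⟨ xor-cancelˡ-common (hx u) (hy w) (hy v) ⟩
      hy w xor hy v                        ≡⟨ hy-invariant w∈ v∈ y∈ ỹ∈ (trans e₂ (sym (κ-agrees-b y∈ ỹ∈))) ⟩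
      hy y xor hy ỹ                        ∎
      where
      open ≡-Reasoning
      k = κ x ỹ
      u = pt₁ k
      v = pt₂ k
      triangle = κ-triangle x y ỹ (pt-col k)
      w = proj₁ triangle
      e₁ : col u w ≡ κ x y
      e₁ = proj₁ (proj₂ triangle)
      e₂ : col w v ≡ κ y ỹ
      e₂ = proj₂ (proj₂ triangle)
      u∈ : col u u ≡ a
      u∈ = trans (κ-source x ỹ) x∈
      v∈ : col v v ≡ b
      v∈ = trans (κ-target x ỹ) ỹ∈
      w∈ : col w w ≡ b
      w∈ = trans (target-col e₁) (trans (κ-target x y) y∈)

    bit-κ-xor : ∀ {x y x̃ ỹ} → col x x ≡ a → col y y ≡ b → col x̃ x̃ ≡ a → col ỹ ỹ ≡ b →
                bit (κ x y) xor bit (κ x̃ ỹ) ≡ bit (col x y) xor bit (col x̃ ỹ)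
    bit-κ-xor {x} {y} {x̃} {ỹ} x∈ y∈ x̃∈ ỹ∈ = begin
      bit (κ x y) xor bit (κ x̃ ỹ)                                   ≡⟨ sym (xor-telescope (bit (κ x y)) (bit (κ x̃ y)) (bit (κ x̃ ỹ))) ⟩
      (bit (κ x y) xor bit (κ x̃ y)) xor (bit (κ x̃ y) xor bit (κ x̃ ỹ)) ≡⟨ cong₂ _xor_ (bit-step-x x∈ x̃∈ y∈) (bit-step-y x̃∈ y∈ ỹ∈) ⟩
      (hx x xor hx x̃) xor (hy y xor hy ỹ)                           ≡⟨ interchange (hx x) (hx x̃) (hy y) (hy ỹ) ⟩
      (hx x xor hy y) xor (hx x̃ xor hy ỹ)                           ≡⟨ sym (cong₂ _xor_ (bit-col x∈ y∈) (bit-col x̃∈ ỹ∈)) ⟩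
      bit (col x y) xor bit (col x̃ ỹ)                               ∎
      where open ≡-Reasoning

    faithful : Faithful a b
    faithful {x} {y} {x̃} {ỹ} x∈ y∈ x̃∈ ỹ∈ = mk⇔
      (λ c → bit-injective (trans (κ-source x y) x∈) (trans (κ-target x y) y∈)
                           (trans (κ-source x̃ ỹ) x̃∈) (trans (κ-target x̃ ỹ) ỹ∈)
                           (Equivalence.from bits (cong bit c)))
      (λ c → bit-injective (trans (sym (source-col refl)) x∈) (trans (sym (target-col refl)) y∈)
                           (trans (sym (source-col refl)) x̃∈) (trans (sym (target-col refl)) ỹ∈)
                           (Equivalence.to bits (cong bit c)))
      where
      bits = xor-≡-⇔ (bit-κ-xor x∈ y∈ x̃∈ ỹ∈)

  φ-bijective : Bijective _≡_ _≡_ φ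
  φ-bijective = φ-injective , λ y′ → proj₁ (φ-surjective y′) , λ {z} z≡x → trans (cong φ z≡x) (proj₂ (φ-surjective y′))

  uniform? : ∀ a b → Dec (Uniform C a b)
  uniform? a b = any? λ j → all? λ u → all? λ v → ((col u u ≟ a) ×-dec (col v v ≟ b)) ⇔-dec (col u v ≟ j)

  module _ (irr : Irredundant C) where

    fiber : ∀ {a} → Diag a → IsFiber C a
    fiber {a} d = (pt₁ a , pt-loop d) , d

    κ-agrees : ∀ {a} → Diag a → AgreesOn a
    κ-agrees d = SmallFiber.κ-fiber d (proj₁ (proj₂ irr) _ (fiber d))

    faithful-all : ∀ {a b} → Diag a → Diag b → Faithful a b
    faithful-all {a} {b} da db with a ≟ b
    ... | yes refl = faithful-fiber (κ-agrees da)
    ... | no a≢b with uniform? a b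
    ... | yes uniform = faithful-uniform uniform
    ... | no ¬uniform with proj₂ (proj₂ irr) a b (fiber da) (fiber db) a≢b ¬uniform
    ... | _ , _ , _ , _ , enX , enY , j₁∈ , _ , blocks =
      DoubleBlock.faithful (κ-agrees da) (κ-agrees db) enX enY j₁∈ blocks

    col⇔κ : ∀ {x y x̃ ỹ} → col x y ≡ col x̃ ỹ ⇔ κ x y ≡ κ x̃ ỹ
    col⇔κ {x} {y} {x̃} {ỹ} = mk⇔
      (λ c → Equivalence.to
        (faithful (trans (source-col refl) (sym (source-col c))) (trans (target-col refl) (sym (target-col c)))) c)
      (λ c → Equivalence.from
        (faithful (trans (sym (κ-source x̃ ỹ)) (trans (cong source (sym c)) (κ-source x y)))
                  (trans (sym (κ-target x̃ ỹ)) (trans (cong target (sym c)) (κ-target x y)))) c)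
      where
      faithful : col x̃ x̃ ≡ col x x → col ỹ ỹ ≡ col y y → col x y ≡ col x̃ ỹ ⇔ κ x y ≡ κ x̃ ỹ
      faithful = faithful-all (loop-Diag x) (loop-Diag y) refl refl

    image : ∀ i → ImageIs C C' φ i (f (κ (pt₁ i) (pt₂ i)))
    image i u′ v′ = mk⇔ to from
      where
      to : InImage C φ i u′ v′ → col′ u′ v′ ≡ f (κ (pt₁ i) (pt₂ i))
      to (u , v , refl , refl , c) =
        trans (sym (f-κ u v)) (cong f (Equivalence.to col⇔κ (trans c (sym (pt-col i)))))
      from : col′ u′ v′ ≡ f (κ (pt₁ i) (pt₂ i)) → InImage C φ i u′ v′
      from c =
        let u , φu≡u′ = φ-surjective u′
            v , φv≡v′ = φ-surjective v′
            κ≡ = f-injective (trans (f-κ u v) (trans (cong₂ col′ φu≡u′ φv≡v′) c))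
        in u , v , φu≡u′ , φv≡v′ , trans (Equivalence.from col⇔κ κ≡) (pt-col i)

    φ-combinatorial : CombIso C C' φ
    φ-combinatorial = φ-bijective , λ i → _ , image i

    φ-on-fibers : ∀ a → IsFiber C a → ∀ i → RelIn C i a a → ImageIs C C' φ i (f i)
    φ-on-fibers a (_ , d) i i∈ =
      subst (ImageIs C C' φ i) (cong f (trans (sym (κ-agrees d p∈ q∈)) (pt-col i))) (image i)
      where
      p∈ = proj₁ (i∈ _ _ (pt-col i))
      q∈ = proj₂ (i∈ _ _ (pt-col i))

lemma7p1 : ∀ {n r n' r'} (C : CC n r) (C' : CC n' r') → Irredundant C →
    (f : Fin r → Fin r') → AlgIso C C' f →
    Σ (Fin n → Fin n') λ φ → CombIso C C' φ ×
      (∀ a → IsFiber C a → ∀ i → RelIn C i a a → ImageIs C C' φ i (f i))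
lemma7p1 C C' irr f alg = φ , φ-combinatorial irr , φ-on-fibers irr
  where open AlgebraicIsomorphism C C' f alg
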